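{- Let $T$, $g$, $\gamma$ be as in the context. Let $C$ be a directed cycle in $T$ with $|C|$ arcs, and let $u^0,\ldots,u^{k-1}$ be the restricted vertices of $C$, listed in the order in which they appear along $C$. For $i=0,\ldots,k-1$ (indices modulo $k$) let $x_i=g(u^{i+1})\gamma(u^{i+1})\,g(u^{i+2})\gamma(u^{i+2})\cdots g(u^{i-1})\gamma(u^{i-1})\,g(u^i)$. Then for each $i$, $u^i=\big(x_i\,\gamma(u^i)\big)^{\frac{n+1}{|C|}-1}\,x_i$.
   Context: Let $A$ be a finite alphabet with a linear order $<$, extended to words by the lexicographic order. Let $\mathcal{F}$ be a set of words over $A$ (forbidden factors). A word $w$ is in the language if the bi-infinite periodic word $\cdots www\cdots$ contains no word of $\mathcal{F}$ as a factor; $W_k$ denotes the set of words of length $k$ in the language. Fix $n\ge1$. Consider the digraph with vertex set $A^n$ having an arc from $as$ to $sb$ ($a,b\in A$, $s\in A^{n-1}$) whenever $asb\in W_{n+1}$; this arc has label $b$. The de Bruijn graph $G_n$ is a strongly connected component of this digraph with the maximum number of vertices (unique when the subshift is irreducible). Vertices are identified with their words; $x^j$ denotes the concatenation of $j$ copies of $x$. Let $m=m_1\cdots m_n$ be the lexicographically maximal vertex of $G_n$. For each vertex $v$ let $e(v)$ be the arc of $G_n$ with tail $v$ of maximum label, and $\gamma(v)$ its label. $T$ is the spanning subgraph of $G_n$ with arc set $\{e(v): v\neq m\}$. For a vertex $u\neq m$, $g(u)$ is the longest word that is both a prefix of $m$ and a suffix of $u$ (possibly empty), and $\alpha(u)=m_{|g(u)|+1}$.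 A vertex $u\neq m$ is restricted if $\gamma(u)<\alpha(u)$. -}

module Defs where

open import Data.Nat using (ℕ; zero; suc; _+_; _∸_; _%_)
open import Data.Nat.DivMod using (m%n<n)
open import Data.Fin using (Fin; toℕ; fromℕ<) renaming (_<_ to _<ᶠ_; _≤_ to _≤ᶠ_)
import Data.Fin as Fin
open import Data.List using (List; []; _∷_; _++_; map; upTo; take; drop; length; lookup; head; concatMap)
open import Data.List.Properties using (≡-dec)
open import Data.List.Membership.Propositional using (_∈_)
open import Data.List.Relation.Unary.Unique.Propositional using (Unique)
open import Data.List.Relation.Binary.Lex.Strict using (Lex-<)
open import Data.Vec using (Vec; toList)
open import Data.Maybe using (just)
open import Data.Product using (Σ; ∃; _×_; _,_)
open import Data.Sum using (_⊎_)
open import Data.Unit using (⊤)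
open import Relation.Nullary using (¬_; yes; no)
open import Relation.Binary.PropositionalEquality using (_≡_)
open import Relation.Binary.Construct.Closure.ReflexiveTransitive using (Star)

-- The alphabet is Fin q with its natural linear order.
Word : ℕ → Set
Word q = List (Fin q)

Vertex : ℕ → ℕ → Set
Vertex q n = Vec (Fin q) n

-- Factor of length ℓ of the bi-infinite periodic word ...www... starting at
-- position i (positions taken modulo |w|); only meaningful for nonempty w.
perFactor : ∀ {q} (a : Fin q) (w : Word q) (i ℓ : ℕ) → Word q
perFactor a w i ℓ =
  map (λ t → lookup (a ∷ w) (fromℕ< (m%n<n (i + t) (length (a ∷ w))))) (upTo ℓ)

-- w is in the language: ...www... contains no forbidden factor.
-- (The empty word is never used; it is given the trivial value.)
InLang : ∀ {q} (F : Word q → Set) → Word q → Set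
InLang F []      = ⊤
InLang F (a ∷ w) = ∀ i ℓ → ¬ F (perFactor a w i ℓ)

-- Arc from u to v with label b in the de Bruijn digraph on A^n:
-- u = a s, v = s b and a s b ∈ W_{n+1}.
Arc : ∀ {q n} (F : Word q → Set) → Vertex q n → Vertex q n → Fin q → Set
Arc F u v b = InLang F (toList u ++ b ∷ []) × toList v ≡ drop 1 (toList u) ++ b ∷ []

Step : ∀ {q n} (F : Word q → Set) → Vertex q n → Vertex q n → Set
Step F u v = ∃ λ b → Arc F u v b

Reach : ∀ {q n} (F : Word q → Set) → Vertex q n → Vertex q n → Set
Reach F = Star (Step F)

-- S (a duplicate-free list of vertices) is a strongly connected component:
-- the class of some vertex w under mutual reachability.
IsSCC : ∀ {q n} (F : Word q → Set) → List (Vertex q n) → Set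
IsSCC F S = Unique S × ∃ λ w → ∀ v →
  ((v ∈ S → Reach F w v × Reach F v w) × (Reach F w v → Reach F v w → v ∈ S))

-- S is (the vertex set of) a de Bruijn graph G_n: an SCC with the maximum
-- number of vertices.
IsDeBruijn : ∀ {q n} (F : Word q → Set) → List (Vertex q n) → Set
IsDeBruijn {q} {n} F S = IsSCC F S × (∀ (S' : List (Vertex q n)) → IsSCC F S' → length S' Data.Nat.≤ length S)

_<lex_ : ∀ {q} → Word q → Word q → Set
_<lex_ = Lex-< _≡_ _<ᶠ_

IsMaxVertex : ∀ {q n} → List (Vertex q n) → Vertex q n → Set
IsMaxVertex S m = m ∈ S × (∀ v → v ∈ S → v ≡ m ⊎ toList v <lex toList m)

IsMaxLabel : ∀ {q n} (F : Word q → Set) → List (Vertex q n) → Vertex q n → Fin q → Set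
IsMaxLabel F S v b =
  (∃ λ w → w ∈ S × Arc F v w b) ×
  (∀ b' w → w ∈ S → Arc F v w b' → b' ≤ᶠ b)

-- g(u): the longest word that is a prefix of m and a suffix of u
-- (search over candidate lengths from the largest down).
gAux : ∀ {q} → Word q → Word q → ℕ → Word q
gAux m u zero = []
gAux m u (suc ℓ) with ≡-dec Fin._≟_ (take (suc ℓ) m) (drop (length u ∸ suc ℓ) u)
... | yes _ = take (suc ℓ) m
... | no  _ = gAux m u ℓ

g : ∀ {q} → Word q → Word q → Word q
g m u = gAux m u (length u)

-- u is restricted (w.r.t. m), where b = γ(u): γ(u) < α(u) = m_{|g(u)|+1}.
Restricted : ∀ {q n} → Vertex q n → Vertex q n → Fin q → Set
Restricted m u b = ∃ λ a →
  head (drop (length (g (toList m) (toList u))) (toList m)) ≡ just a × b <ᶠ a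

cyc : ∀ {k} → Fin k → ℕ → Fin k
cyc {suc k} i t = fromℕ< (m%n<n (toℕ i + t) (suc k))

-- x^i = g(u^{i+1})γ(u^{i+1}) ... g(u^{i-1})γ(u^{i-1}) g(u^i), with
-- U j = u^j and Γ j = γ(u^j), indices modulo k.
xWord : ∀ {q k} (m : Word q) (U : Fin k → Word q) (Γ : Fin k → Fin q) → Fin k → Word q
xWord {k = k} m U Γ i =
  concatMap (λ t → g m (U (cyc i t)) ++ Γ (cyc i t) ∷ []) (map suc (upTo (k ∸ 1)))
  ++ g m (U i)

pow : ∀ {q} → Word q → ℕ → Word q
pow w zero    = []
pow w (suc j) = w ++ pow w j

module Submission where

-- Unroll the cycle C = c₀ → … → c_L of T to positions x ∈ ℕ: the vertex at
-- position x is Vx x = c_{x mod ℓ} (ℓ = |C| = L + 1) and β x is its label, so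
-- every vertex is spelled by the n labels read before it (window).
--  1. Rotating the word of an arc yields an arc (Graph).  Hence an arc labelled
--     β x leaves Vx (x + n + 1), so β x ≤ β (x + n + 1) by maximality of labels;
--     going once around C turns these inequalities into equalities.  Thus β and
--     Vx have period n + 1, and since C has distinct vertices, ℓ ∣ n + 1.
--  2. Borders (w.r.t. the maximal vertex m): every arc u → u' of G_n has label
--     at most α(u).  So along an unrestricted vertex g grows by the label read,
--     and after a restricted vertex g is empty (g-extend, g-reset, g-run).
--  3. Enumerating the restricted positions in order by P, each word
--     g(u^{i+1}) γ(u^{i+1}) is the slice of labels from u^i to u^{i+1}; these
--     telescope, so x_i γ(u^i) is the period of ℓ labels read after u^i.
--  4. Reading u^i off the n = (e + 1) ℓ - 1 labels after it gives
--     u^i = (x_i γ(u^i))^e x_i.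

open import Defs
open import Data.Nat using (ℕ; zero; suc; _+_; _*_; _∸_; _≤_; _<_; _≤′_; ≤′-refl; ≤′-step; z≤n; s≤s; _%_; _/_)
open import Data.Nat.Properties
open import Data.Nat.DivMod
open import Data.Nat.Divisibility using (divides; m%n≡0⇒n∣m; n∣m*n)
open import Data.Nat.Tactic.RingSolver using (solve-∀)
open import Data.Fin using (Fin; toℕ; fromℕ<) renaming (_<_ to _<ᶠ_; _≤_ to _≤ᶠ_)
import Data.Fin as Fin
import Data.Fin.Properties as FinP
open import Data.List using (List; []; _∷_; _++_; _∷ʳ_; map; upTo; take; drop; length; lookup; head; concatMap)
open import Data.List.Properties
open import Data.List.Membership.Propositional using (_∈_)
open import Data.List.Relation.Binary.Lex.Core using (this; next)
open import Data.Vec using (Vec; toList; fromList; cast) renaming (_∷_ to _∷ᵥ_)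
open import Data.Vec.Properties using (toList-injective; cast-is-id; toList-cast; toList∘fromList; length-toList)
open import Data.Maybe using (just)
open import Data.Product using (Σ; ∃; _×_; _,_; proj₁; proj₂)
open import Data.Sum using (_⊎_; inj₁; inj₂)
open import Data.Empty using (⊥-elim)
open import Function.Bundles using (_⇔_; mk⇔; Equivalence)
open import Relation.Nullary using (¬_; yes; no)
open import Relation.Binary.PropositionalEquality
open import Relation.Binary.Construct.Closure.ReflexiveTransitive using (ε; _◅_; _◅◅_)

-- Slices of infinite words

slice : ∀ {A : Set} → (ℕ → A) → ℕ → ℕ → List A
slice f x zero    = []
slice f x (suc l) = f x ∷ slice f (suc x) l

slice-++ : ∀ {A : Set} (f : ℕ → A) x l₁ l₂ →
  slice f x (l₁ + l₂) ≡ slice f x l₁ ++ slice f (x + l₁) l₂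
slice-++ f x zero     l₂ = cong (λ y → slice f y l₂) (sym (+-identityʳ x))
slice-++ f x (suc l₁) l₂ = cong (f x ∷_) (begin
    slice f (suc x) (l₁ + l₂)
  ≡⟨ slice-++ f (suc x) l₁ l₂ ⟩
    slice f (suc x) l₁ ++ slice f (suc x + l₁) l₂
  ≡⟨ cong (λ y → slice f (suc x) l₁ ++ slice f y l₂) (sym (+-suc x l₁)) ⟩
    slice f (suc x) l₁ ++ slice f (x + suc l₁) l₂ ∎)
  where open ≡-Reasoning

slice-∷ʳ : ∀ {A : Set} (f : ℕ → A) x l → slice f x (suc l) ≡ slice f x l ∷ʳ f (x + l)
slice-∷ʳ f x l = trans (cong (slice f x) (+-comm 1 l)) (slice-++ f x l 1)

slice-shift : ∀ {A : Set} (f : ℕ → A) d → (∀ y → f (y + d) ≡ f y) →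
  ∀ x l → slice f (x + d) l ≡ slice f x l
slice-shift f d per x zero    = refl
slice-shift f d per x (suc l) = cong₂ _∷_ (per x) (slice-shift f d per (suc x) l)

slice-pow : ∀ {q} (f : ℕ → Fin q) ℓ → (∀ y → f (y + ℓ) ≡ f y) →
  ∀ x r e → slice f x (r + e * ℓ) ≡ pow (slice f x ℓ) e ++ slice f x r
slice-pow f ℓ per x r zero    = cong (slice f x) (+-identityʳ r)
slice-pow f ℓ per x r (suc e) = begin
    slice f x (r + (ℓ + e * ℓ))
  ≡⟨ cong (slice f x) (swap r ℓ (e * ℓ)) ⟩
    slice f x (ℓ + (r + e * ℓ))
  ≡⟨ slice-++ f x ℓ (r + e * ℓ) ⟩
    slice f x ℓ ++ slice f (x + ℓ) (r + e * ℓ)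
  ≡⟨ cong (slice f x ℓ ++_) (slice-shift f ℓ per x (r + e * ℓ)) ⟩
    slice f x ℓ ++ slice f x (r + e * ℓ)
  ≡⟨ cong (slice f x ℓ ++_) (slice-pow f ℓ per x r e) ⟩
    slice f x ℓ ++ (pow (slice f x ℓ) e ++ slice f x r)
  ≡⟨ sym (++-assoc (slice f x ℓ) (pow (slice f x ℓ) e) (slice f x r)) ⟩
    pow (slice f x ℓ) (suc e) ++ slice f x r ∎
  where
    open ≡-Reasoning
    swap : ∀ a b c → a + (b + c) ≡ b + (a + c)
    swap = solve-∀

length-∷ʳ : ∀ {A : Set} (l : List A) a → length (l ∷ʳ a) ≡ suc (length l)
length-∷ʳ l a = trans (length-++ l) (+-comm (length l) 1)

length-take-≤ : ∀ {A : Set} t (l : List A) → t ≤ length l → length (take t l) ≡ t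
length-take-≤ t l t≤l = trans (length-take t l) (m≤n⇒m⊓n≡m t≤l)

drop-++ˡ : ∀ {A : Set} t (l r : List A) → t ≤ length l → drop t (l ++ r) ≡ drop t l ++ r
drop-++ˡ zero    l       r _         = refl
drop-++ˡ (suc t) (x ∷ l) r (s≤s t≤l) = drop-++ˡ t l r t≤l

-- LetterAt l i a: the letter of l at (0-based) position i is a.
LetterAt : ∀ {A : Set} → List A → ℕ → A → Set
LetterAt l i a = head (drop i l) ≡ just a

letterAt-exists : ∀ {A : Set} i (l : List A) → i < length l → ∃ (LetterAt l i)
letterAt-exists zero    (x ∷ l) _         = x , refl
letterAt-exists (suc i) (x ∷ l) (s≤s i<l) = letterAt-exists i l i<l

letterAt-drop : ∀ {A : Set} i (l : List A) {a} → LetterAt l i a → drop i l ≡ a ∷ drop (suc i) l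
letterAt-drop zero    (x ∷ l) refl = refl
letterAt-drop (suc i) (x ∷ l) at   = letterAt-drop i l at

letterAt-take : ∀ {A : Set} i (l : List A) {a} → LetterAt l i a → take (suc i) l ≡ take i l ∷ʳ a
letterAt-take zero    (x ∷ l) refl = refl
letterAt-take (suc i) (x ∷ l) at   = cong (x ∷_) (letterAt-take i l at)

letterAt-split : ∀ {A : Set} i (l : List A) {a} → LetterAt l i a → l ≡ take i l ++ a ∷ drop (suc i) l
letterAt-split i l at = trans (sym (take++drop≡id i l)) (cong (take i l ++_) (letterAt-drop i l at))

toList-inj : ∀ {A : Set} {n} (u v : Vec A n) → toList u ≡ toList v → u ≡ v
toList-inj u v e = trans (sym (cast-is-id refl u)) (toList-injective refl u v e)

vertexOf : ∀ {A : Set} {n} (l : List A) → length l ≡ n → Σ (Vec A n) λ v → toList v ≡ l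
vertexOf l e = cast e (fromList l) , trans (toList-cast e (fromList l)) (toList∘fromList l)

rotate : ∀ {A : Set} → List A → List A
rotate []      = []
rotate (a ∷ w) = w ∷ʳ a

rotateⁿ : ∀ {A : Set} → ℕ → List A → List A
rotateⁿ zero    w = w
rotateⁿ (suc j) w = rotateⁿ j (rotate w)

rotateⁿ-++ : ∀ {A : Set} (x y : List A) → rotateⁿ (length x) (x ++ y) ≡ y ++ x
rotateⁿ-++ []      y = sym (++-identityʳ y)
rotateⁿ-++ (a ∷ x) y = begin
    rotateⁿ (length x) ((x ++ y) ∷ʳ a)
  ≡⟨ cong (rotateⁿ (length x)) (++-assoc x y (a ∷ [])) ⟩
    rotateⁿ (length x) (x ++ y ∷ʳ a)
  ≡⟨ rotateⁿ-++ x (y ∷ʳ a) ⟩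
    (y ∷ʳ a) ++ x
  ≡⟨ ∷ʳ-++ y a x ⟩
    y ++ a ∷ x ∎
  where open ≡-Reasoning

-- The language is closed under rotation

nth : ∀ {A : Set} → List A → ℕ → A → A
nth []      j       d = d
nth (x ∷ l) zero    d = x
nth (x ∷ l) (suc j) d = nth l j d

lookup-fromℕ< : ∀ {A : Set} (l : List A) j (j<l : j < length l) d → lookup l (fromℕ< j<l) ≡ nth l j d
lookup-fromℕ< (x ∷ l) zero    _         d = refl
lookup-fromℕ< (x ∷ l) (suc j) (s≤s j<l) d = lookup-fromℕ< l j j<l d

nth-++ˡ : ∀ {A : Set} (l r : List A) j d → j < length l → nth (l ++ r) j d ≡ nth l j d
nth-++ˡ (x ∷ l) r zero    d _         = refl
nth-++ˡ (x ∷ l) r (suc j) d (s≤s j<l) = nth-++ˡ l r j d j<l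

nth-∷ʳ-last : ∀ {A : Set} (l : List A) a d → nth (l ∷ʳ a) (length l) d ≡ a
nth-∷ʳ-last []      a d = refl
nth-∷ʳ-last (x ∷ l) a d = nth-∷ʳ-last l a d

suc-% : ∀ x N → suc x % suc N ≡ suc (x % suc N) % suc N
suc-% x N = begin
    suc x % suc N
  ≡⟨ cong (λ y → suc y % suc N) (m≡m%n+[m/n]*n x (suc N)) ⟩
    (suc (x % suc N) + (x / suc N) * suc N) % suc N
  ≡⟨ [m+kn]%n≡m%n (suc (x % suc N)) (x / suc N) (suc N) ⟩
    suc (x % suc N) % suc N ∎
  where open ≡-Reasoning

nth-rotate : ∀ {A : Set} (l : List A) a x d →
  nth (l ∷ʳ a) (x % suc (length l)) d ≡ nth (a ∷ l) (suc x % suc (length l)) d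
nth-rotate l a x d =
  trans (reduced (x % suc (length l)) (m%n<n x (suc (length l))))
        (cong (λ y → nth (a ∷ l) y d) (sym (suc-% x (length l))))
  where
    wraps : suc (length l) % suc (length l) ≡ 0
    wraps = n%n≡0 (suc (length l))
    reduced : ∀ r → r < suc (length l) → nth (l ∷ʳ a) r d ≡ nth (a ∷ l) (suc r % suc (length l)) d
    reduced r r<N with m≤n⇒m<n∨m≡n r<N
    ... | inj₁ 1+r<N rewrite m<n⇒m%n≡m 1+r<N = nth-++ˡ l (a ∷ []) r d (≤-pred 1+r<N)
    ... | inj₂ refl rewrite wraps = nth-∷ʳ-last l a d

perFactor-rotate : ∀ {q} (a h : Fin q) (w : Word q) i ℓ →
  perFactor h (w ∷ʳ a) i ℓ ≡ perFactor a (h ∷ w) (suc i) ℓ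
perFactor-rotate a h w i ℓ = map-cong letter (upTo ℓ)
  where
    N : ℕ
    N = length (a ∷ h ∷ w)
    letter : ∀ t → lookup (h ∷ w ∷ʳ a) (fromℕ< (m%n<n (i + t) (length (h ∷ w ∷ʳ a))))
                 ≡ lookup (a ∷ h ∷ w) (fromℕ< (m%n<n (suc i + t) N))
    letter t = begin
        lookup (h ∷ w ∷ʳ a) (fromℕ< (m%n<n (i + t) (length (h ∷ w ∷ʳ a))))
      ≡⟨ lookup-fromℕ< (h ∷ w ∷ʳ a) _ (m%n<n (i + t) (length (h ∷ w ∷ʳ a))) h ⟩
        nth (h ∷ w ∷ʳ a) ((i + t) % length (h ∷ w ∷ʳ a)) h
      ≡⟨ cong (λ K → nth (h ∷ w ∷ʳ a) ((i + t) % suc K) h) (length-∷ʳ w a) ⟩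
        nth ((h ∷ w) ∷ʳ a) ((i + t) % suc (length (h ∷ w))) h
      ≡⟨ nth-rotate (h ∷ w) a (i + t) h ⟩
        nth (a ∷ h ∷ w) (suc (i + t) % N) h
      ≡⟨ sym (lookup-fromℕ< (a ∷ h ∷ w) _ (m%n<n (suc i + t) N) h) ⟩
        lookup (a ∷ h ∷ w) (fromℕ< (m%n<n (suc i + t) N)) ∎
      where open ≡-Reasoning

-- If a ∷ w is in the language then so is its rotation w ∷ʳ a: both have
-- the same bi-infinite periodic word.
inLang-rotate : ∀ {q} (F : Word q → Set) (a : Fin q) (w : Word q) → InLang F (a ∷ w) → InLang F (w ∷ʳ a)
inLang-rotate F a []      ok = ok
inLang-rotate F a (h ∷ w) ok i ℓ forbidden = ok (suc i) ℓ (subst F (perFactor-rotate a h w i ℓ) forbidden)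

-- Longest borders

Border : ∀ {q} → Word q → Word q → ℕ → Set
Border m u l = take l m ≡ drop (length u ∸ l) u

record LongestBorder {q} (m u : Word q) (bound : ℕ) (w : Word q) : Set where
  field
    len     : ℕ
    len≤    : len ≤ bound
    word    : w ≡ take len m
    border  : Border m u len
    longest : ∀ l → l ≤ bound → Border m u l → l ≤ len

gAux-longest : ∀ {q} (m u : Word q) bound → LongestBorder m u bound (gAux m u bound)
gAux-longest m u zero = record
  { len = 0 ; len≤ = z≤n ; word = refl
  ; border = sym (drop-all (length u) u ≤-refl) ; longest = λ l l≤0 _ → l≤0 }
gAux-longest m u (suc bound) with ≡-dec Fin._≟_ (take (suc bound) m) (drop (length u ∸ suc bound) u)
... | yes top = record
  { len = suc bound ; len≤ = ≤-refl ; word = refl ; border = top ; longest = λ l l≤ _ → l≤ }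
... | no ¬top = record
  { len = len ; len≤ = m≤n⇒m≤1+n len≤ ; word = word ; border = border ; longest = longest′ }
  where
    open LongestBorder (gAux-longest m u bound)
    longest′ : ∀ l → l ≤ suc bound → Border m u l → l ≤ len
    longest′ l l≤ bl with m≤n⇒m<n∨m≡n l≤
    ... | inj₁ l<  = longest l (≤-pred l<) bl
    ... | inj₂ refl = ⊥-elim (¬top bl)

g-longest : ∀ {q} (m u : Word q) → LongestBorder m u (length u) (g m u)
g-longest m u = gAux-longest m u (length u)

lex-next-≤ : ∀ {q} (p : Word q) a r₁ d r₂ → (p ++ a ∷ r₁) <lex (p ++ d ∷ r₂) → a ≤ᶠ d
lex-next-≤ []      a r₁ d r₂ (this a<d)    = <⇒≤ a<d
lex-next-≤ []      a r₁ d r₂ (next refl _) = ≤-refl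
lex-next-≤ (x ∷ p) a r₁ d r₂ (this x<x)    = ⊥-elim (<-irrefl refl x<x)
lex-next-≤ (x ∷ p) a r₁ d r₂ (next _ rest) = lex-next-≤ p a r₁ d r₂ rest

∸-telescope : ∀ {a b c} → a ≤ b → b ≤ c → (b ∸ a) + (c ∸ b) ≡ c ∸ a
∸-telescope {a} {b} {c} a≤b b≤c = begin
    (b ∸ a) + (c ∸ b)
  ≡⟨ +-comm (b ∸ a) (c ∸ b) ⟩
    (c ∸ b) + (b ∸ a)
  ≡⟨ sym (+-∸-assoc (c ∸ b) a≤b) ⟩
    ((c ∸ b) + b) ∸ a
  ≡⟨ cong (_∸ a) (m∸n+n≡m b≤c) ⟩
    c ∸ a ∎
  where open ≡-Reasoning

suc-∸-suc : ∀ {a b} → a < b → suc (b ∸ suc a) ≡ b ∸ a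
suc-∸-suc a<b = sym (+-∸-assoc 1 a<b)

concatMap-upTo-suc : ∀ {A : Set} (f : ℕ → List A) t →
  concatMap f (map suc (upTo (suc t))) ≡ concatMap f (map suc (upTo t)) ++ f (suc t)
concatMap-upTo-suc f t = begin
    concatMap f (map suc (upTo (suc t)))
  ≡⟨ cong (λ xs → concatMap f (map suc xs)) (sym (applyUpTo-∷ʳ (λ x → x) t)) ⟩
    concatMap f (map suc (upTo t ∷ʳ t))
  ≡⟨ cong (concatMap f) (map-++ suc (upTo t) (t ∷ [])) ⟩
    concatMap f (map suc (upTo t) ++ suc t ∷ [])
  ≡⟨ concatMap-++ f (map suc (upTo t)) (suc t ∷ []) ⟩
    concatMap f (map suc (upTo t)) ++ (f (suc t) ++ [])
  ≡⟨ cong (concatMap f (map suc (upTo t)) ++_) (++-identityʳ (f (suc t))) ⟩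
    concatMap f (map suc (upTo t)) ++ f (suc t) ∎
  where open ≡-Reasoning

-- The de Bruijn digraph on words of length n = n' + 1

module Graph {q : ℕ} (n' : ℕ) (F : Word q → Set) where

  private
    n : ℕ
    n = suc n'
    V : Set
    V = Vertex q n

  -- An arc labelled b leaves u exactly when u b is in the language, and
  -- rotating that word j times traces a walk of j arcs from u.
  rotation-walk : ∀ j (u : V) b → InLang F (toList u ∷ʳ b) →
    ∃ λ u' → ∃ λ b' → (toList u' ∷ʳ b' ≡ rotateⁿ j (toList u ∷ʳ b)) × Reach F u u'
  rotation-walk zero    u        b ok = u , b , refl , ε
  rotation-walk (suc j) (h ∷ᵥ t) b ok
    with vertexOf (toList t ∷ʳ b) (trans (length-∷ʳ (toList t) b) (cong suc (length-toList t)))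
  ... | u₁ , u₁≡
    with rotation-walk j u₁ h (subst (λ w → InLang F (w ∷ʳ h)) (sym u₁≡) (inLang-rotate F h (toList t ∷ʳ b) ok))
  ... | u' , b' , u'≡ , walk =
    u' , b' , trans u'≡ (cong (λ w → rotateⁿ j (w ∷ʳ h)) u₁≡) , ((b , ok , u₁≡) ◅ walk)

  -- Every arc lies on a closed walk: n further rotations of its word lead
  -- back to its tail.
  arc-returns : ∀ {u z : V} {b} → Arc F u z b → Reach F z u
  arc-returns {h ∷ᵥ t} {z} {b} (ok , z≡)
    with rotation-walk n z h (subst (λ w → InLang F (w ∷ʳ h)) (sym z≡) (inLang-rotate F h (toList t ∷ʳ b) ok))
  ... | u' , b' , u'≡ , walk =
    subst (Reach F z) (toList-inj u' (h ∷ᵥ t) (∷ʳ-injectiveˡ (toList u') (toList (h ∷ᵥ t)) back)) walk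
    where
      w : Word q
      w = toList (h ∷ᵥ t) ∷ʳ b
      length-w : length w ≡ suc n
      length-w = trans (length-∷ʳ (toList (h ∷ᵥ t)) b) (cong suc (length-toList (h ∷ᵥ t)))
      back : toList u' ∷ʳ b' ≡ w
      back = begin
          toList u' ∷ʳ b'
        ≡⟨ u'≡ ⟩
          rotateⁿ n (toList z ∷ʳ h)
        ≡⟨ cong (λ x → rotateⁿ n (x ∷ʳ h)) z≡ ⟩
          rotateⁿ (suc n) w
        ≡⟨ cong (λ j → rotateⁿ j w) (sym length-w) ⟩
          rotateⁿ (length w) w
        ≡⟨ cong (rotateⁿ (length w)) (sym (++-identityʳ w)) ⟩
          rotateⁿ (length w) (w ++ [])
        ≡⟨ rotateⁿ-++ w [] ⟩
          w ∎
        where open ≡-Reasoning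

  HasOutArc : V → Set
  HasOutArc u = ∃ λ b → ∃ λ z → Arc F u z b

  module SCC (S : List V) (scc : IsSCC F S) where

    private
      root : V
      root = proj₁ (proj₂ scc)
      member : ∀ v → (v ∈ S → Reach F root v × Reach F v root) × (Reach F root v → Reach F v root → v ∈ S)
      member = proj₂ (proj₂ scc)

    -- S is closed under arcs, since every arc lies on a closed walk.
    arc-closed : ∀ {u z : V} {b} → u ∈ S → Arc F u z b → z ∈ S
    arc-closed {u} {z} {b} u∈S arc = proj₂ (member z)
      (proj₁ (proj₁ (member u) u∈S) ◅◅ ((b , arc) ◅ ε))
      (arc-returns arc ◅◅ proj₂ (proj₁ (member u) u∈S))

    -- If one vertex of S has an out-arc then all do: each one reaches it.
    out-arcs : ∀ v → v ∈ S → HasOutArc v → ∀ u → u ∈ S → HasOutArc u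
    out-arcs v v∈S arc-v u u∈S =
      first-arc (proj₂ (proj₁ (member u) u∈S) ◅◅ proj₁ (proj₁ (member v) v∈S))
      where
        first-arc : ∀ {u} → Reach F u v → HasOutArc u
        first-arc ε                = arc-v
        first-arc ((b , arc) ◅ _) = b , _ , arc

    walk-drop : (∀ u → u ∈ S → HasOutArc u) → ∀ t (z₀ : V) → z₀ ∈ S →
      ∃ λ z → z ∈ S × ∃ λ r → toList z ≡ drop t (toList z₀) ++ r
    walk-drop arcs zero    z₀ z₀∈S = z₀ , z₀∈S , [] , sym (++-identityʳ (toList z₀))
    walk-drop arcs (suc t) z₀ z₀∈S with walk-drop arcs t z₀ z₀∈S
    ... | z , z∈S , r , z≡ =
      subst (λ d → ∃ λ z → z ∈ S × ∃ λ r → toList z ≡ d ++ r)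
            (trans (drop-drop t 1 (toList z₀)) (cong (λ j → drop j (toList z₀)) (+-comm t 1)))
            (one-more (drop t (toList z₀)) z≡)
      where
        one-more : ∀ d → toList z ≡ d ++ r → ∃ λ z' → z' ∈ S × ∃ λ r' → toList z' ≡ drop 1 d ++ r'
        one-more []      _   = z , z∈S , toList z , refl
        one-more (x ∷ d) z≡d with arcs z z∈S
        ... | b , z' , arc@(_ , z'≡) = z' , arc-closed z∈S arc , r ∷ʳ b ,
          trans z'≡ (trans (cong (λ w → drop 1 w ∷ʳ b) z≡d) (++-assoc d r (b ∷ [])))

module Borders {q : ℕ} (n' : ℕ) (F : Word q → Set)
  (S : List (Vertex q (suc n'))) (scc : IsSCC F S)
  (m : Vertex q (suc n')) (m-max : IsMaxVertex S m)
  (arcs : ∀ u → u ∈ S → Graph.HasOutArc n' F u) where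

  open Graph n' F
  open SCC S scc

  private
    n : ℕ
    n = suc n'
    V : Set
    V = Vertex q n

  mL : Word q
  mL = toList m

  IsBorder : V → ℕ → Set
  IsBorder u l = take l mL ≡ drop (n ∸ l) (toList u)

  private
    LB : (u : V) → LongestBorder mL (toList u) (length (toList u)) (g mL (toList u))
    LB u = g-longest mL (toList u)

  gLen : V → ℕ
  gLen u = LongestBorder.len (LB u)

  gLen≤n : ∀ u → gLen u ≤ n
  gLen≤n u = subst (gLen u ≤_) (length-toList u) (LongestBorder.len≤ (LB u))

  gLen-border : ∀ u → IsBorder u (gLen u)
  gLen-border u = subst (λ N → take (gLen u) mL ≡ drop (N ∸ gLen u) (toList u))
                        (length-toList u) (LongestBorder.border (LB u))

  gLen-longest : ∀ u l → l ≤ n → IsBorder u l → l ≤ gLen u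
  gLen-longest u l l≤n bl = LongestBorder.longest (LB u) l
    (subst (l ≤_) (sym (length-toList u)) l≤n)
    (subst (λ N → take l mL ≡ drop (N ∸ l) (toList u)) (sym (length-toList u)) bl)

  g≡take : ∀ u → g mL (toList u) ≡ take (gLen u) mL
  g≡take u = LongestBorder.word (LB u)

  gLen<n : ∀ u → u ≢ m → gLen u < n
  gLen<n u u≢m with m≤n⇒m<n∨m≡n (gLen≤n u)
  ... | inj₁ short = short
  ... | inj₂ full  = ⊥-elim (u≢m (toList-inj u m (sym (begin
          mL
        ≡⟨ sym (take-all n mL (≤-reflexive (length-toList m))) ⟩
          take n mL
        ≡⟨ cong (λ l → take l mL) (sym full) ⟩
          take (gLen u) mL
        ≡⟨ gLen-border u ⟩
          drop (n ∸ gLen u) (toList u)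
        ≡⟨ cong (λ l → drop (n ∸ l) (toList u)) full ⟩
          drop (n ∸ n) (toList u)
        ≡⟨ cong (λ j → drop j (toList u)) (n∸n≡0 n) ⟩
          toList u ∎))))
    where open ≡-Reasoning

  α-exists : ∀ u → u ≢ m → ∃ (LetterAt mL (gLen u))
  α-exists u u≢m = letterAt-exists (gLen u) mL (subst (gLen u <_) (sym (length-toList m)) (gLen<n u u≢m))

  restricted⇔ : ∀ {u b} → Restricted m u b ⇔ (∃ λ a → LetterAt mL (gLen u) a × b <ᶠ a)
  restricted⇔ {u} = mk⇔
    (λ (a , at , b<a) → a , subst (λ l → LetterAt mL l a) length-g at , b<a)
    (λ (a , at , b<a) → a , subst (λ l → LetterAt mL l a) (sym length-g) at , b<a)
    where
      length-g : length (g mL (toList u)) ≡ gLen u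
      length-g = trans (cong length (g≡take u))
        (length-take-≤ (gLen u) mL (subst (gLen u ≤_) (sym (length-toList m)) (gLen≤n u)))

  Successor : V → V → Fin q → Set
  Successor u u' b = toList u' ≡ drop 1 (toList u) ∷ʳ b

  suffix-succ : ∀ {u u' b} → Successor u u' b → ∀ h → h < n →
    drop (n ∸ suc h) (toList u') ≡ drop (n ∸ h) (toList u) ∷ʳ b
  suffix-succ {u} {u'} {b} succ h h<n = begin
      drop (n ∸ suc h) (toList u')
    ≡⟨ cong (drop (n ∸ suc h)) succ ⟩
      drop (n ∸ suc h) (drop 1 (toList u) ∷ʳ b)
    ≡⟨ drop-++ˡ (n ∸ suc h) (drop 1 (toList u)) (b ∷ []) fits ⟩
      drop (n ∸ suc h) (drop 1 (toList u)) ∷ʳ b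
    ≡⟨ cong (_∷ʳ b) (drop-drop 1 (n ∸ suc h) (toList u)) ⟩
      drop (suc (n ∸ suc h)) (toList u) ∷ʳ b
    ≡⟨ cong (λ j → drop j (toList u) ∷ʳ b) (suc-∸-suc h<n) ⟩
      drop (n ∸ h) (toList u) ∷ʳ b ∎
    where
      open ≡-Reasoning
      fits : n ∸ suc h ≤ length (drop 1 (toList u))
      fits = subst (n ∸ suc h ≤_) (sym (trans (length-drop 1 (toList u)) (cong (_∸ 1) (length-toList u))))
                   (∸-monoʳ-≤ {m = 1} {n = suc h} n (s≤s z≤n))

  border-pred : ∀ {u u' b} → Successor u u' b → ∀ h → suc h ≤ n → IsBorder u' (suc h) →
    LetterAt mL h b × IsBorder u h
  border-pred {u} {u'} {b} succ h h<n bl with letterAt-exists h mL (subst (h <_) (sym (length-toList m)) h<n)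
  ... | a , at with ∷ʳ-injective (take h mL) (drop (n ∸ h) (toList u))
                      (trans (sym (letterAt-take h mL at)) (trans bl (suffix-succ succ h h<n)))
  ... | border , refl = at , border

  gLen-succ-≤ : ∀ {u u' b} → Successor u u' b → gLen u' ≤ suc (gLen u)
  gLen-succ-≤ {u} {u'} succ = bound (gLen u') (gLen≤n u') (gLen-border u')
    where
      bound : ∀ l → l ≤ n → IsBorder u' l → l ≤ suc (gLen u)
      bound zero    _   _  = z≤n
      bound (suc h) h<n bl = s≤s (gLen-longest u h (<⇒≤ h<n) (proj₂ (border-pred succ h h<n bl)))

  g-extend : ∀ {u u' b} → Successor u u' b → u ≢ m → LetterAt mL (gLen u) b →
    g mL (toList u') ≡ g mL (toList u) ∷ʳ b
  g-extend {u} {u'} {b} succ u≢m at = begin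
      g mL (toList u')
    ≡⟨ g≡take u' ⟩
      take (gLen u') mL
    ≡⟨ cong (λ l → take l mL) (≤-antisym (gLen-succ-≤ {u} succ) (gLen-longest u' (suc G) (gLen<n u u≢m) grown)) ⟩
      take (suc G) mL
    ≡⟨ letterAt-take G mL at ⟩
      take G mL ∷ʳ b
    ≡⟨ cong (_∷ʳ b) (sym (g≡take u)) ⟩
      g mL (toList u) ∷ʳ b ∎
    where
      open ≡-Reasoning
      G : ℕ
      G = gLen u
      grown : IsBorder u' (suc G)
      grown = trans (letterAt-take G mL at)
        (trans (cong (_∷ʳ b) (gLen-border u)) (sym (suffix-succ succ G (gLen<n u u≢m))))

  below-max : ∀ {z} → z ∈ S → ∀ p {a d r₁ r₂} → toList z ≡ p ++ a ∷ r₁ → mL ≡ p ++ d ∷ r₂ → a ≤ᶠ d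
  below-max z∈S p z≡ m≡ with proj₂ m-max _ z∈S
  ... | inj₁ refl = ≤-reflexive (cong toℕ (∷-injectiveˡ (++-cancelˡ p _ _ (trans (sym z≡) m≡))))
  ... | inj₂ z<m  = lex-next-≤ p _ _ _ _ (subst₂ _<lex_ z≡ m≡ z<m)

  -- Every arc u → u' of G_n has label b ≤ α(u): walking on from u' yields
  -- a vertex of G_n that begins with g(u) b, while m begins with g(u) α(u).
  label-≤-α : ∀ {u u' b a} → u' ∈ S → Successor u u' b → u ≢ m → LetterAt mL (gLen u) a → b ≤ᶠ a
  label-≤-α {u} {u'} {b} u'∈S succ u≢m at with walk-drop arcs (n ∸ suc (gLen u)) u' u'∈S
  ... | z , z∈S , r , z≡ = below-max z∈S (take G mL) z-starts (letterAt-split G mL at)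
    where
      G : ℕ
      G = gLen u
      z-starts : toList z ≡ take G mL ++ b ∷ r
      z-starts = begin
          toList z
        ≡⟨ z≡ ⟩
          drop (n ∸ suc G) (toList u') ++ r
        ≡⟨ cong (_++ r) (suffix-succ succ G (gLen<n u u≢m)) ⟩
          (drop (n ∸ G) (toList u) ∷ʳ b) ++ r
        ≡⟨ cong (λ w → (w ∷ʳ b) ++ r) (sym (gLen-border u)) ⟩
          (take G mL ∷ʳ b) ++ r
        ≡⟨ ∷ʳ-++ (take G mL) b r ⟩
          take G mL ++ b ∷ r ∎
        where open ≡-Reasoning

  -- A border of u' of length h + 1 gives
  -- m_{h+1} = b with h ≤ |g(u)|; walking |g(u)| - h steps from m then
  -- reaches a vertex of G_n beginning with m_1..m_h α(u), beating m.
  g-reset : ∀ {u u' b a} → Successor u u' b → LetterAt mL (gLen u) a → b <ᶠ a → g mL (toList u') ≡ []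
  g-reset {u} {u'} {b} {a} succ at b<a =
    trans (g≡take u') (cong (λ l → take l mL) (no-border (gLen u') (gLen≤n u') (gLen-border u')))
    where
      G : ℕ
      G = gLen u
      no-border : ∀ l → l ≤ n → IsBorder u' l → l ≡ 0
      no-border zero    _   _  = refl
      no-border (suc h) h<n bl with border-pred succ h h<n bl
      ... | at-h , border-h with walk-drop arcs (G ∸ h) m (proj₁ m-max)
      ... | z , z∈S , r , z≡ = ⊥-elim (<⇒≱ b<a (below-max z∈S (take h mL) z-starts (letterAt-split h mL at-h)))
        where
          open ≡-Reasoning
          h≤G : h ≤ G
          h≤G = gLen-longest u h (<⇒≤ h<n) border-h
          G≤m : G ≤ length (take G mL)
          G≤m = ≤-reflexive (sym (length-take-≤ G mL (subst (G ≤_) (sym (length-toList m)) (gLen≤n u))))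
          shifted : drop (G ∸ h) (take G mL) ≡ take h mL
          shifted = begin
              drop (G ∸ h) (take G mL)
            ≡⟨ cong (drop (G ∸ h)) (gLen-border u) ⟩
              drop (G ∸ h) (drop (n ∸ G) (toList u))
            ≡⟨ drop-drop (n ∸ G) (G ∸ h) (toList u) ⟩
              drop ((n ∸ G) + (G ∸ h)) (toList u)
            ≡⟨ cong (λ j → drop j (toList u)) (trans (+-comm (n ∸ G) (G ∸ h)) (∸-telescope h≤G (gLen≤n u))) ⟩
              drop (n ∸ h) (toList u)
            ≡⟨ sym border-h ⟩
              take h mL ∎
          z-starts : toList z ≡ take h mL ++ a ∷ (drop (suc G) mL ++ r)
          z-starts = begin
              toList z
            ≡⟨ z≡ ⟩
              drop (G ∸ h) mL ++ r
            ≡⟨ cong (λ w → drop (G ∸ h) w ++ r) (letterAt-split G mL at) ⟩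
              drop (G ∸ h) (take G mL ++ a ∷ drop (suc G) mL) ++ r
            ≡⟨ cong (_++ r) (drop-++ˡ (G ∸ h) (take G mL) _ (≤-trans (m∸n≤m G h) G≤m)) ⟩
              (drop (G ∸ h) (take G mL) ++ a ∷ drop (suc G) mL) ++ r
            ≡⟨ cong (λ w → (w ++ a ∷ drop (suc G) mL) ++ r) shifted ⟩
              (take h mL ++ a ∷ drop (suc G) mL) ++ r
            ≡⟨ ++-assoc (take h mL) (a ∷ drop (suc G) mL) r ⟩
              take h mL ++ a ∷ (drop (suc G) mL ++ r) ∎

module Cycle {q : ℕ} (n' : ℕ) (F : Word q → Set)
  (S : List (Vertex q (suc n'))) (deb : IsDeBruijn F S)
  (m : Vertex q (suc n')) (m-max : IsMaxVertex S m)
  (L : ℕ) (c : Fin (suc L) → Vertex q (suc n')) (b : Fin (suc L) → Fin q)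
  (c∈S : ∀ j → c j ∈ S) (c≢m : ∀ j → c j ≢ m)
  (b-max : ∀ j → IsMaxLabel F S (c j) (b j))
  (c-step : ∀ j → toList (c (cyc j 1)) ≡ drop 1 (toList (c j)) ++ b j ∷ [])
  (c-inj : ∀ i j → c i ≡ c j → i ≡ j) where

  n ℓ : ℕ
  n = suc n'
  ℓ = suc L

  open Graph n' F
  open SCC S (proj₁ deb)

  -- Every vertex of G_n has an out-arc, since c₀ does.
  arcs : ∀ u → u ∈ S → HasOutArc u
  arcs = out-arcs (c Fin.zero) (c∈S Fin.zero) (b Fin.zero , proj₁ (proj₁ (b-max Fin.zero)) , proj₂ (proj₂ (proj₁ (b-max Fin.zero))))

  open Borders n' F S (proj₁ deb) m m-max arcs

  cy : ℕ → Fin ℓ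
  cy x = cyc Fin.zero x

  toℕ-cy : ∀ x → toℕ (cy x) ≡ x % ℓ
  toℕ-cy x = FinP.toℕ-fromℕ< (m%n<n x ℓ)

  cy-suc : ∀ x → cyc (cy x) 1 ≡ cy (suc x)
  cy-suc x = FinP.toℕ-injective (begin
      toℕ (cyc (cy x) 1)
    ≡⟨ FinP.toℕ-fromℕ< (m%n<n (toℕ (cy x) + 1) ℓ) ⟩
      (toℕ (cy x) + 1) % ℓ
    ≡⟨ cong (λ y → (y + 1) % ℓ) (toℕ-cy x) ⟩
      (x % ℓ + 1) % ℓ
    ≡⟨ cong (_% ℓ) (+-comm (x % ℓ) 1) ⟩
      suc (x % ℓ) % ℓ
    ≡⟨ sym (suc-% x L) ⟩
      suc x % ℓ
    ≡⟨ sym (toℕ-cy (suc x)) ⟩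
      toℕ (cy (suc x)) ∎)
    where open ≡-Reasoning

  cy-periodic : ∀ x j → cy (x + j * ℓ) ≡ cy x
  cy-periodic x j = FinP.toℕ-injective
    (trans (toℕ-cy (x + j * ℓ)) (trans ([m+kn]%n≡m%n x j ℓ) (sym (toℕ-cy x))))

  cy-toℕ : ∀ j → cy (toℕ j) ≡ j
  cy-toℕ j = FinP.toℕ-injective (trans (toℕ-cy (toℕ j)) (m<n⇒m%n≡m (FinP.toℕ<n j)))

  Vx : ℕ → Vertex q n
  Vx x = c (cy x)

  β : ℕ → Fin q
  β x = b (cy x)

  β-period : ∀ x → β (x + ℓ) ≡ β x
  β-period x = cong b (trans (cong cy (cong (x +_) (sym (*-identityˡ ℓ)))) (cy-periodic x 1))

  Vx-succ : ∀ x → Successor (Vx x) (Vx (suc x)) (β x)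
  Vx-succ x = subst (λ j → toList (c j) ≡ drop 1 (toList (Vx x)) ∷ʳ β x) (cy-suc x) (c-step (cy x))

  arc-word : ∀ x → InLang F (toList (Vx x) ∷ʳ β x)
  arc-word x = proj₁ (proj₂ (proj₂ (proj₁ (b-max (cy x)))))

  Vx-steps : ∀ x t → t ≤ n → toList (Vx (x + t)) ≡ drop t (toList (Vx x)) ++ slice β x t
  Vx-steps x zero _ = trans (cong (λ y → toList (Vx y)) (+-identityʳ x)) (sym (++-identityʳ _))
  Vx-steps x (suc t) t<n = begin
      toList (Vx (x + suc t))
    ≡⟨ cong (λ y → toList (Vx y)) (+-suc x t) ⟩
      toList (Vx (suc (x + t)))
    ≡⟨ Vx-succ (x + t) ⟩
      drop 1 (toList (Vx (x + t))) ∷ʳ β (x + t)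
    ≡⟨ cong (λ w → drop 1 w ∷ʳ β (x + t)) (Vx-steps x t (<⇒≤ t<n)) ⟩
      drop 1 (drop t (toList (Vx x)) ++ slice β x t) ∷ʳ β (x + t)
    ≡⟨ cong (_∷ʳ β (x + t)) (drop-++ˡ 1 (drop t (toList (Vx x))) (slice β x t) nonempty) ⟩
      (drop 1 (drop t (toList (Vx x))) ++ slice β x t) ∷ʳ β (x + t)
    ≡⟨ ++-assoc (drop 1 (drop t (toList (Vx x)))) (slice β x t) (β (x + t) ∷ []) ⟩
      drop 1 (drop t (toList (Vx x))) ++ (slice β x t ∷ʳ β (x + t))
    ≡⟨ cong₂ _++_ (trans (drop-drop t 1 _) (cong (λ j → drop j (toList (Vx x))) (+-comm t 1)))
                  (sym (slice-∷ʳ β x t)) ⟩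
      drop (suc t) (toList (Vx x)) ++ slice β x (suc t) ∎
    where
      open ≡-Reasoning
      nonempty : 1 ≤ length (drop t (toList (Vx x)))
      nonempty = subst (1 ≤_) (sym (trans (length-drop t (toList (Vx x))) (cong (_∸ t) (length-toList (Vx x)))))
                       (m<n⇒0<n∸m t<n)

  window : ∀ x → toList (Vx (x + n)) ≡ slice β x n
  window x = trans (Vx-steps x n ≤-refl)
    (cong (_++ slice β x n) (drop-all n (toList (Vx x)) (≤-reflexive (length-toList (Vx x)))))

  -- Rotating the arc word β x … β (x+n) of position x + n gives an arc
  -- labelled β x out of Vx (x + n + 1); as β is the maximal label there,
  -- β x ≤ β (x + n + 1).
  β-rotation-≤ : ∀ x → β x ≤ᶠ β (x + suc n)
  β-rotation-≤ x = subst (λ y → β x ≤ᶠ β y) (sym (+-suc x n))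
    (proj₂ (b-max (cy (suc x + n))) (β x) z (arc-closed (c∈S _) arc) arc)
    where
      v : Vertex q n
      v = Vx (suc x + n)
      rotated : InLang F (toList v ∷ʳ β x)
      rotated = subst (λ w → InLang F (w ∷ʳ β x)) (sym (window (suc x)))
        (inLang-rotate F (β x) (slice β (suc x) n)
          (subst (InLang F) (trans (cong (_∷ʳ β (x + n)) (window x)) (sym (slice-∷ʳ β x n))) (arc-word (x + n))))
      length-n : length (drop 1 (toList v) ∷ʳ β x) ≡ n
      length-n = trans (length-∷ʳ (drop 1 (toList v)) (β x))
        (cong suc (trans (length-drop 1 (toList v)) (cong (_∸ 1) (length-toList v))))
      z : Vertex q n
      z = proj₁ (vertexOf (drop 1 (toList v) ∷ʳ β x) length-n)
      arc : Arc F v z (β x)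
      arc = rotated , proj₂ (vertexOf (drop 1 (toList v) ∷ʳ β x) length-n)

  β-rotation-≤ⁿ : ∀ x j → β x ≤ᶠ β (x + j * suc n)
  β-rotation-≤ⁿ x zero    = ≤-reflexive (cong (λ y → toℕ (β y)) (sym (+-identityʳ x)))
  β-rotation-≤ⁿ x (suc j) = ≤-trans (β-rotation-≤ x)
    (subst (λ y → β (x + suc n) ≤ᶠ β y) (+-assoc x (suc n) (j * suc n)) (β-rotation-≤ⁿ (x + suc n) j))

  -- Going once around (ℓ rotations) returns to the start, so all these
  -- inequalities are equalities: β has period n + 1.
  β-period-n+1 : ∀ x → β (x + suc n) ≡ β x
  β-period-n+1 x = FinP.≤-antisym around (β-rotation-≤ x)
    where
      around : β (x + suc n) ≤ᶠ β x
      around = subst (λ y → β (x + suc n) ≤ᶠ y)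
        (trans (cong β (trans (+-assoc x (suc n) (L * suc n)) (cong (x +_) (*-comm ℓ (suc n)))))
               (cong b (cy-periodic x (suc n))))
        (β-rotation-≤ⁿ (x + suc n) L)

  -- Hence Vx has period n + 1 too (it is spelled by the preceding labels),
  -- and since the vertices of C are distinct, ℓ divides n + 1.
  ℓ∣n+1 : suc n % ℓ ≡ 0
  ℓ∣n+1 = begin
      suc n % ℓ
    ≡⟨ sym ([m+kn]%n≡m%n (suc n) n ℓ) ⟩
      (suc n + n * ℓ) % ℓ
    ≡⟨ cong (_% ℓ) (+-comm (suc n) (n * ℓ)) ⟩
      (n * ℓ + suc n) % ℓ
    ≡⟨ sym (toℕ-cy (n * ℓ + suc n)) ⟩
      toℕ (cy (n * ℓ + suc n))
    ≡⟨ cong toℕ (c-inj _ _ (subst (λ y → Vx (y + suc n) ≡ Vx y) x+n≡ same-vertex)) ⟩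
      toℕ (cy (n * ℓ))
    ≡⟨ toℕ-cy (n * ℓ) ⟩
      (n * ℓ) % ℓ
    ≡⟨ m*n%n≡0 n ℓ ⟩
      0 ∎
    where
      open ≡-Reasoning
      x : ℕ
      x = n * L
      x+n≡ : x + n ≡ n * ℓ
      x+n≡ = trans (+-comm x n) (sym (*-suc n L))
      same-vertex : Vx (x + n + suc n) ≡ Vx (x + n)
      same-vertex = toList-inj _ _ (begin
          toList (Vx (x + n + suc n))
        ≡⟨ cong (λ y → toList (Vx y)) (+-comm-inner x n (suc n)) ⟩
          toList (Vx ((x + suc n) + n))
        ≡⟨ window (x + suc n) ⟩
          slice β (x + suc n) n
        ≡⟨ slice-shift β (suc n) β-period-n+1 x n ⟩
          slice β x n
        ≡⟨ sym (window x) ⟩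
          toList (Vx (x + n)) ∎)
        where
          +-comm-inner : ∀ a d e → a + d + e ≡ a + e + d
          +-comm-inner = solve-∀

  cycle-length : ∃ λ e → suc e * ℓ ≡ suc n
  cycle-length with m%n≡0⇒n∣m (suc n) ℓ ℓ∣n+1
  ... | divides (suc e) n+1≡ = e , sym n+1≡

  Vx-power : ∀ s e → suc e * ℓ ≡ suc n → toList (Vx s) ≡ pow (slice β (suc s) ℓ) e ++ slice β (suc s) L
  Vx-power s e len = begin
      toList (Vx s)
    ≡⟨ cong (λ j → toList (c j)) (sym (cy-periodic s (suc e))) ⟩
      toList (Vx (s + suc e * ℓ))
    ≡⟨ cong (λ y → toList (Vx (s + y))) len ⟩
      toList (Vx (s + suc n))
    ≡⟨ cong (λ y → toList (Vx y)) (+-suc s n) ⟩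
      toList (Vx (suc s + n))
    ≡⟨ window (suc s) ⟩
      slice β (suc s) n
    ≡⟨ cong (slice β (suc s)) (suc-injective (sym len)) ⟩
      slice β (suc s) (L + e * ℓ)
    ≡⟨ slice-pow β ℓ β-period (suc s) L e ⟩
      pow (slice β (suc s) ℓ) e ++ slice β (suc s) L ∎
    where open ≡-Reasoning

  Rp : ℕ → Set
  Rp x = Restricted m (Vx x) (β x)

  -- At an unrestricted position γ = α (since γ ≤ α always), so the
  -- border grows by the label read.
  g-step-free : ∀ x → ¬ Rp x → g mL (toList (Vx (suc x))) ≡ g mL (toList (Vx x)) ∷ʳ β x
  g-step-free x free with α-exists (Vx x) (c≢m (cy x))
  ... | a , at = g-extend {Vx x} (Vx-succ x) (c≢m (cy x)) (subst (LetterAt mL (gLen (Vx x))) a≡β at)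
    where
      a≡β : a ≡ β x
      a≡β = FinP.≤-antisym
        (≮⇒≥ (λ β<a → free (Equivalence.from (restricted⇔ {Vx x} {β x}) (a , at , β<a))))
        (label-≤-α {Vx x} (c∈S (cy (suc x))) (Vx-succ x) (c≢m (cy x)) at)

  g-step-restricted : ∀ x → Rp x → g mL (toList (Vx (suc x))) ≡ []
  g-step-restricted x R with Equivalence.to (restricted⇔ {Vx x} {β x}) R
  ... | a , at , β<a = g-reset {Vx x} (Vx-succ x) at β<a

  g-run : ∀ y d → Rp y → (∀ j → j < d → ¬ Rp (suc y + j)) →
    g mL (toList (Vx (suc y + d))) ≡ slice β (suc y) d
  g-run y zero    Ry _    = trans (cong (λ z → g mL (toList (Vx z))) (+-identityʳ (suc y))) (g-step-restricted y Ry)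
  g-run y (suc d) Ry free = begin
      g mL (toList (Vx (suc y + suc d)))
    ≡⟨ cong (λ z → g mL (toList (Vx z))) (+-suc (suc y) d) ⟩
      g mL (toList (Vx (suc (suc y + d))))
    ≡⟨ g-step-free (suc y + d) (free d ≤-refl) ⟩
      g mL (toList (Vx (suc y + d))) ∷ʳ β (suc y + d)
    ≡⟨ cong (_∷ʳ β (suc y + d)) (g-run y d Ry (λ j j<d → free j (m<n⇒m<1+n j<d))) ⟩
      slice β (suc y) d ∷ʳ β (suc y + d)
    ≡⟨ sym (slice-∷ʳ β (suc y) d) ⟩
      slice β (suc y) (suc d) ∎
    where open ≡-Reasoning

  -- The restricted vertices u⁰, …, u^{k-1} = c (p 0), …, c (p k') of C,
  -- listed in order along C.
  module Enumeration (k' : ℕ) (p : Fin (suc k') → Fin ℓ)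
    (p-mono : ∀ i i' → i <ᶠ i' → p i <ᶠ p i')
    (p-restricted : ∀ i → Restricted m (c (p i)) (b (p i)))
    (p-onto : ∀ j → Restricted m (c j) (b j) → ∃ λ i → p i ≡ j) where

    k : ℕ
    k = suc k'

    cyk : ℕ → Fin k
    cyk x = cyc Fin.zero x

    -- P x: the position of u^{x mod k} in the (x / k)-th turn of the cycle;
    -- P enumerates the restricted positions in increasing order.
    P : ℕ → ℕ
    P x = toℕ (p (cyk x)) + (x / k) * ℓ

    cyk-at : ∀ (i : Fin k) Q → cyk (toℕ i + Q * k) ≡ i
    cyk-at i Q = FinP.toℕ-injective (begin
        toℕ (cyk (toℕ i + Q * k))
      ≡⟨ FinP.toℕ-fromℕ< (m%n<n (toℕ i + Q * k) k) ⟩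
        (toℕ i + Q * k) % k
      ≡⟨ [m+kn]%n≡m%n (toℕ i) Q k ⟩
        toℕ i % k
      ≡⟨ m<n⇒m%n≡m (FinP.toℕ<n i) ⟩
        toℕ i ∎)
      where open ≡-Reasoning

    P-at : ∀ (i : Fin k) Q → P (toℕ i + Q * k) ≡ toℕ (p i) + Q * ℓ
    P-at i Q = cong₂ (λ j Q' → toℕ (p j) + Q' * ℓ) (cyk-at i Q) turn
      where
        turn : (toℕ i + Q * k) / k ≡ Q
        turn = trans (+-distrib-/-∣ʳ (toℕ i) (n∣m*n Q))
                     (cong₂ _+_ (m<n⇒m/n≡0 (FinP.toℕ<n i)) (m*n/n≡m Q k))

    P-vertex : ∀ x → cy (P x) ≡ p (cyk x)
    P-vertex x = FinP.toℕ-injective (begin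
        toℕ (cy (P x))
      ≡⟨ toℕ-cy (P x) ⟩
        (toℕ (p (cyk x)) + (x / k) * ℓ) % ℓ
      ≡⟨ [m+kn]%n≡m%n (toℕ (p (cyk x))) (x / k) ℓ ⟩
        toℕ (p (cyk x)) % ℓ
      ≡⟨ m<n⇒m%n≡m (FinP.toℕ<n (p (cyk x))) ⟩
        toℕ (p (cyk x)) ∎)
      where open ≡-Reasoning

    P-restricted : ∀ x → Rp (P x)
    P-restricted x = subst (λ j → Restricted m (c j) (b j)) (sym (P-vertex x)) (p-restricted (cyk x))

    -- Within a turn P increases because p does; passing to the next turn
    -- it increases because every position of a turn is below ℓ.
    P-increasing : ∀ x → P x < P (suc x)
    P-increasing x = by-position (m≤n⇒m<n∨m≡n (FinP.toℕ<n j))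
      where
        j : Fin k
        j = cyk x
        Q : ℕ
        Q = x / k
        x≡ : x ≡ toℕ j + Q * k
        x≡ = trans (m≡m%n+[m/n]*n x k) (cong (_+ Q * k) (sym (FinP.toℕ-fromℕ< (m%n<n x k))))
        by-position : suc (toℕ j) < k ⊎ suc (toℕ j) ≡ k → P x < P (suc x)
        by-position (inj₁ next-in-turn) = subst (P x <_) (sym (trans (cong P (sym suc-x≡)) (P-at j' Q))) within
          where
            j' : Fin k
            j' = fromℕ< next-in-turn
            suc-x≡ : toℕ j' + Q * k ≡ suc x
            suc-x≡ = trans (cong (_+ Q * k) (FinP.toℕ-fromℕ< next-in-turn)) (cong suc (sym x≡))
            within : P x < toℕ (p j') + Q * ℓ
            within = +-monoˡ-< (Q * ℓ) (p-mono j j' (≤-reflexive (sym (FinP.toℕ-fromℕ< next-in-turn))))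
        by-position (inj₂ last-in-turn) = subst (P x <_) (sym (trans (cong P (sym suc-x≡)) (P-at Fin.zero (suc Q)))) next-turn
          where
            suc-x≡ : suc Q * k ≡ suc x
            suc-x≡ = trans (cong (_+ Q * k) (sym last-in-turn)) (cong suc (sym x≡))
            next-turn : P x < toℕ (p Fin.zero) + suc Q * ℓ
            next-turn = <-≤-trans (+-monoˡ-< (Q * ℓ) (FinP.toℕ<n (p j))) (m≤n+m (suc Q * ℓ) _)

    P-monotone : ∀ {x y} → x ≤ y → P x ≤ P y
    P-monotone x≤y = along (≤⇒≤′ x≤y)
      where
        along : ∀ {x y} → x ≤′ y → P x ≤ P y
        along ≤′-refl       = ≤-refl
        along (≤′-step x≤y) = ≤-trans (along x≤y) (<⇒≤ (P-increasing _))

    P-onto : ∀ y → Rp y → ∃ λ x → P x ≡ y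
    P-onto y Ry with p-onto (cy y) Ry
    ... | i , pi≡ = toℕ i + (y / ℓ) * k , (begin
        P (toℕ i + (y / ℓ) * k)
      ≡⟨ P-at i (y / ℓ) ⟩
        toℕ (p i) + (y / ℓ) * ℓ
      ≡⟨ cong (λ j → toℕ j + (y / ℓ) * ℓ) pi≡ ⟩
        toℕ (cy y) + (y / ℓ) * ℓ
      ≡⟨ cong (_+ (y / ℓ) * ℓ) (toℕ-cy y) ⟩
        y % ℓ + (y / ℓ) * ℓ
      ≡⟨ sym (m≡m%n+[m/n]*n y ℓ) ⟩
        y ∎)
      where open ≡-Reasoning

    P-next : ∀ t y → P t < y → Rp y → P (suc t) ≤ y
    P-next t y Pt<y Ry with P-onto y Ry
    ... | x , refl = P-monotone (≰⇒> (λ x≤t → <⇒≱ Pt<y (P-monotone {x} {t} x≤t)))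

    blockWord : ℕ → Word q
    blockWord x = g mL (toList (c (p (cyk x)))) ∷ʳ b (p (cyk x))

    blockWord-slice : ∀ t → blockWord (suc t) ≡ slice β (suc (P t)) (P (suc t) ∸ P t)
    blockWord-slice t = begin
        blockWord (suc t)
      ≡⟨ cong (λ j → g mL (toList (c j)) ∷ʳ b j) (sym (P-vertex (suc t))) ⟩
        g mL (toList (Vx (P (suc t)))) ∷ʳ β (P (suc t))
      ≡⟨ cong (λ y → g mL (toList (Vx y)) ∷ʳ β y) (sym ends) ⟩
        g mL (toList (Vx (suc (P t) + d))) ∷ʳ β (suc (P t) + d)
      ≡⟨ cong (_∷ʳ β (suc (P t) + d)) (g-run (P t) d (P-restricted t) unrestricted) ⟩
        slice β (suc (P t)) d ∷ʳ β (suc (P t) + d)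
      ≡⟨ sym (slice-∷ʳ β (suc (P t)) d) ⟩
        slice β (suc (P t)) (suc d)
      ≡⟨ cong (slice β (suc (P t))) (suc-∸-suc (P-increasing t)) ⟩
        slice β (suc (P t)) (P (suc t) ∸ P t) ∎
      where
        open ≡-Reasoning
        d : ℕ
        d = P (suc t) ∸ suc (P t)
        ends : suc (P t) + d ≡ P (suc t)
        ends = m+[n∸m]≡n (P-increasing t)
        unrestricted : ∀ j → j < d → ¬ Rp (suc (P t) + j)
        unrestricted j j<d R = <⇒≱ (subst (suc (P t) + j <_) ends (+-monoʳ-< (suc (P t)) j<d))
                                   (P-next t _ (s≤s (m≤m+n (P t) j)) R)

    telescope : ∀ a T → concatMap (λ t → blockWord (a + t)) (map suc (upTo T)) ≡ slice β (suc (P a)) (P (a + T) ∸ P a)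
    telescope a zero    = cong (slice β (suc (P a))) (sym (trans (cong (λ x → P x ∸ P a) (+-identityʳ a)) (n∸n≡0 (P a))))
    telescope a (suc T) = begin
        concatMap block (map suc (upTo (suc T)))
      ≡⟨ concatMap-upTo-suc block T ⟩
        concatMap block (map suc (upTo T)) ++ blockWord (a + suc T)
      ≡⟨ cong₂ _++_ (telescope a T) (trans (cong blockWord (+-suc a T)) (blockWord-slice (a + T))) ⟩
        slice β (suc (P a)) D₁ ++ slice β (suc (P (a + T))) D₂
      ≡⟨ cong (λ y → slice β (suc (P a)) D₁ ++ slice β (suc y) D₂) (sym (m+[n∸m]≡n Pa≤)) ⟩
        slice β (suc (P a)) D₁ ++ slice β (suc (P a) + D₁) D₂
      ≡⟨ sym (slice-++ β (suc (P a)) D₁ D₂) ⟩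
        slice β (suc (P a)) (D₁ + D₂)
      ≡⟨ cong (slice β (suc (P a))) (∸-telescope Pa≤ (<⇒≤ (P-increasing (a + T)))) ⟩
        slice β (suc (P a)) (P (suc (a + T)) ∸ P a)
      ≡⟨ cong (λ x → slice β (suc (P a)) (P x ∸ P a)) (sym (+-suc a T)) ⟩
        slice β (suc (P a)) (P (a + suc T) ∸ P a) ∎
      where
        open ≡-Reasoning
        block : ℕ → Word q
        block t = blockWord (a + t)
        Pa≤ : P a ≤ P (a + T)
        Pa≤ = P-monotone (m≤m+n a T)
        D₁ D₂ : ℕ
        D₁ = P (a + T) ∸ P a
        D₂ = P (suc (a + T)) ∸ P (a + T)

    X : Fin k → Word q
    X = xWord mL (λ i' → toList (c (p i'))) (λ i' → b (p i'))

    -- x_i γ(u^i) is the period of labels read after u^i: the k blocks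
    -- from u^{i+1} around to u^i = u^{i+k}.
    X-period : ∀ i → X i ∷ʳ b (p i) ≡ slice β (suc (toℕ (p i))) ℓ
    X-period i = begin
        X i ∷ʳ b (p i)
      ≡⟨ ++-assoc (concatMap block (map suc (upTo k'))) (g mL (toList (c (p i)))) (b (p i) ∷ []) ⟩
        concatMap block (map suc (upTo k')) ++ (g mL (toList (c (p i))) ∷ʳ b (p i))
      ≡⟨ cong (λ j → concatMap block (map suc (upTo k')) ++ (g mL (toList (c (p j))) ∷ʳ b (p j))) (sym cyk-end) ⟩
        concatMap block (map suc (upTo k')) ++ block k
      ≡⟨ sym (concatMap-upTo-suc block k') ⟩
        concatMap block (map suc (upTo k))
      ≡⟨ telescope a k ⟩
        slice β (suc (P a)) (P (a + k) ∸ P a)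
      ≡⟨ cong₂ (λ s e → slice β (suc s) (e ∸ s)) start end ⟩
        slice β (suc (toℕ (p i))) (toℕ (p i) + ℓ ∸ toℕ (p i))
      ≡⟨ cong (slice β (suc (toℕ (p i)))) (m+n∸m≡n (toℕ (p i)) ℓ) ⟩
        slice β (suc (toℕ (p i))) ℓ ∎
      where
        open ≡-Reasoning
        a : ℕ
        a = toℕ i
        block : ℕ → Word q
        block t = blockWord (a + t)
        a+k≡ : a + k ≡ a + 1 * k
        a+k≡ = cong (a +_) (sym (*-identityˡ k))
        cyk-end : cyk (a + k) ≡ i
        cyk-end = trans (cong cyk a+k≡) (cyk-at i 1)
        start : P a ≡ toℕ (p i)
        start = trans (cong P (sym (+-identityʳ a))) (trans (P-at i 0) (+-identityʳ _))
        end : P (a + k) ≡ toℕ (p i) + ℓ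
        end = trans (cong P a+k≡) (trans (P-at i 1) (cong (toℕ (p i) +_) (*-identityˡ ℓ)))

    restricted-vertex-form : ∀ i e → suc e * ℓ ≡ suc n → toList (c (p i)) ≡ pow (X i ∷ʳ b (p i)) e ++ X i
    restricted-vertex-form i e len = begin
        toList (c (p i))
      ≡⟨ cong (λ j → toList (c j)) (sym (cy-toℕ (p i))) ⟩
        toList (Vx s)
      ≡⟨ Vx-power s e len ⟩
        pow (slice β (suc s) ℓ) e ++ slice β (suc s) L
      ≡⟨ cong₂ (λ w w' → pow w e ++ w') (sym (X-period i)) remainder ⟩
        pow (X i ∷ʳ b (p i)) e ++ X i ∎
      where
        open ≡-Reasoning
        s : ℕ
        s = toℕ (p i)
        remainder : slice β (suc s) L ≡ X i
        remainder = ∷ʳ-injectiveˡ (slice β (suc s) L) (X i) (trans (sym (slice-∷ʳ β (suc s) L)) (sym (X-period i)))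

-- The exponent e comes from |C| ∣ n + 1 (cycle-length); the form of u^i is
-- restricted-vertex-form.  The cases n = 0 and k = 0 are vacuous.
theorem3 : (q n : ℕ) → 1 ≤ n → (F : Word q → Set)
    → (S : List (Vertex q n)) → IsDeBruijn F S
    → (m : Vertex q n) → IsMaxVertex S m
    → (L : ℕ) (c : Fin (suc L) → Vertex q n) (b : Fin (suc L) → Fin q)
    → (∀ j → c j ∈ S)
    → (∀ j → c j ≢ m)
    → (∀ j → IsMaxLabel F S (c j) (b j))
    → (∀ j → toList (c (cyc j 1)) ≡ drop 1 (toList (c j)) ++ b j ∷ [])
    → (∀ i j → c i ≡ c j → i ≡ j)
    → (k : ℕ) (p : Fin k → Fin (suc L))
    → (∀ i i' → i <ᶠ i' → p i <ᶠ p i')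
    → (∀ i → Restricted m (c (p i)) (b (p i)))
    → (∀ j → Restricted m (c j) (b j) → ∃ λ i → p i ≡ j)
    → ∀ i → ∃ λ e →
        suc e * suc L ≡ suc n
        × toList (c (p i))
          ≡ pow (xWord (toList m) (λ i' → toList (c (p i'))) (λ i' → b (p i')) i ++ b (p i) ∷ []) e
            ++ xWord (toList m) (λ i' → toList (c (p i'))) (λ i' → b (p i')) i
theorem3 q zero () F S deb m m-max L c b c∈S c≢m b-max c-step c-inj k p p-mono p-restricted p-onto i
theorem3 q (suc n') _ F S deb m m-max L c b c∈S c≢m b-max c-step c-inj zero p p-mono p-restricted p-onto ()
theorem3 q (suc n') _ F S deb m m-max L c b c∈S c≢m b-max c-step c-inj (suc k') p p-mono p-restricted p-onto i =
  e , len , restricted-vertex-form i e len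
  where
    open Cycle n' F S deb m m-max L c b c∈S c≢m b-max c-step c-inj
    open Enumeration k' p p-mono p-restricted p-onto
    e : ℕ
    e = proj₁ cycle-length
    len : suc e * suc L ≡ suc (suc n')
    len = proj₂ cycle-length
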